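{- Let $(V,d)$ be a finite metric with root $r\in V$ and let $\pi$ be any master tour on $(V,d)$ (a tour starting at $r$ visiting all vertices). Let $\{q_v\}_{v\in V}$ and $\{\bar p_v\}_{v\in V}$ be probabilities in $[0,1]$ and let $\beta\le 1$ be a constant such that $\beta\bar p_v\le q_v\le \bar p_v$ for each $v\in V$. Then the expected latency of $\pi$ under the independent activation probabilities $\{q_v\}$ is at least $\beta^3$ times its expected latency under the independent activation probabilities $\{\bar p_v\}$.
   Context: Given independent activation probabilities $\{x_v\}_{v\in V}$, a random active set $A\subseteq V$ contains each $v$ independently with probability $x_v$. The tour $\pi_A$ visits the vertices of $A$ in the order of $\pi$, starting from $r$ and shortcutting over $V\setminus A$. For $v\in A$, $\mathsf{LAT}^A_\pi(v)$ is the length of the path along $\pi_A$ from $r$ to $v$. The expected latency of $\pi$ under $\{x_v\}$ is $\mathbb{E}_A\big[\sum_{v\in A}\mathsf{LAT}^A_\pi(v)\big]$.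
   Formalization: The distances of the metric, the probabilities $\{q_v\}$ and $\{\bar p_v\}$, and the constant β take rational values rather than real ones. -}

module Defs where
open import Data.Nat using (ℕ; zero; suc)

open import Data.Bool using (Bool; true; false; if_then_else_)
open import Data.Fin using (Fin)
open import Data.Vec using (Vec; []; _∷_; lookup)
open import Data.List using (List; []; _∷_; _++_; map; foldr; filter; allFin)
open import Data.List.Relation.Binary.Permutation.Propositional using (_↭_)
open import Data.Rational using (ℚ; 0ℚ; 1ℚ; _+_; _*_; _-_; _≤_)
open import Relation.Binary.PropositionalEquality using (_≡_)
open import Data.Product using (_×_; Σ)

sumℚ : List ℚ → ℚ
sumℚ = foldr _+_ 0ℚ

prodℚ : List ℚ → ℚ
prodℚ = foldr _*_ 1ℚ

record IsMetric {n : ℕ} (d : Fin n → Fin n → ℚ) : Set where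
  field
    nonneg   : ∀ x y → 0ℚ ≤ d x y
    zero-iff : ∀ x y → d x y ≡ 0ℚ → x ≡ y
    refl0    : ∀ x → d x x ≡ 0ℚ
    symm     : ∀ x y → d x y ≡ d y x
    triangle : ∀ x y z → d x z ≤ d x y + d y z

IsMasterTour : {n : ℕ} → Fin n → List (Fin n) → Set
IsMasterTour {n} r π = Σ (List (Fin n)) (λ rest → (π ≡ r ∷ rest) × (π ↭ allFin n))

Subset : ℕ → Set
Subset n = Vec Bool n

allSubsets : (n : ℕ) → List (Subset n)
allSubsets zero = [] ∷ []
allSubsets (suc n) = map (true ∷_) (allSubsets n) ++ map (false ∷_) (allSubsets n)


restrict : {n : ℕ} → Subset n → List (Fin n) → List (Fin n)
restrict A [] = []
restrict A (v ∷ vs) = if lookup A v then v ∷ restrict A vs else restrict A vs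

latencies : {n : ℕ} → (Fin n → Fin n → ℚ) → Fin n → ℚ → List (Fin n) → List ℚ
latencies d prev acc [] = []
latencies d prev acc (v ∷ vs) = (acc + d prev v) ∷ latencies d v (acc + d prev v) vs

-- Σ_{v ∈ A} LAT^A_π(v): tour π_A starts at r and shortcuts over V \ A.
totalLatency : {n : ℕ} → (Fin n → Fin n → ℚ) → Fin n → List (Fin n) → Subset n → ℚ
totalLatency d r π A = sumℚ (latencies d r 0ℚ (restrict A π))

probSet : {n : ℕ} → (Fin n → ℚ) → Subset n → ℚ
probSet {n} x A = prodℚ (map (λ v → if lookup A v then x v else 1ℚ - x v) (allFin n))

expectedLatency : {n : ℕ} → (Fin n → Fin n → ℚ) → Fin n → List (Fin n) → (Fin n → ℚ) → ℚ
expectedLatency {n} d r π x =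
  sumℚ (map (λ A → probSet x A * totalLatency d r π A) (allSubsets n))

{-# OPTIONS --safe #-}
module Submission where

-- By linearity, the expected latency is a sum over the legs (u, w) of π_A, where the leg
-- u → w is paid by w and by every active vertex after it.  For a leg between consecutive
-- active vertices, the probability that u and w are active and every vertex between them
-- inactive drops by at most β² when p̄ is replaced by q (the inactivity factors only grow),
-- and the expected number of active vertices from w on drops by at most β: hence β³.  The
-- leg leaving the root loses only β².  Conditioning on the vertices of π one at a time puts
-- this sum into a recursive closed form in which the comparison is made term by term.

open import Defs
open import Data.Nat using (ℕ; zero; suc)
open import Data.Fin as Fin using (Fin; zero; suc)
open import Data.Bool using (Bool; true; false; if_then_else_)
open import Data.Vec using (_∷_; lookup; _[_]≔_)
open import Data.Vec.Properties using (lookup∘update; lookup∘update′)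
open import Data.List using (List; []; _∷_; _++_; map)
open import Data.List.Properties using (map-++; map-cong; map-∘; map-tabulate)
open import Data.List.Relation.Unary.All using (All; []; _∷_)
open import Data.List.Relation.Unary.Unique.Propositional using (Unique; []; _∷_)
open import Data.List.Relation.Unary.Unique.Propositional.Properties using (allFin⁺)
open import Data.List.Relation.Binary.Permutation.Propositional using (↭-sym; ↭⇒↭ₛ)
import Data.List.Relation.Binary.Permutation.Setoid.Properties as ↭ₛ
open import Data.Rational using (ℚ; 0ℚ; 1ℚ; _+_; _*_; _-_; _≤_; -_; NonPositive; nonNegative; nonPositive)
open import Data.Rational.Properties
open import Relation.Nullary.Decidable using (dec⇒maybe)
open import Data.Product using (_,_)
open import Data.Sum using ([_,_]′)
open import Function using (_∘_; id; const)
open import Relation.Binary.PropositionalEquality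
  using (_≡_; _≢_; refl; sym; trans; cong; cong₂; subst; subst₂; setoid; module ≡-Reasoning)
open import Tactic.RingSolver using (solve-∀)
open import Tactic.RingSolver.Core.AlmostCommutativeRing using (AlmostCommutativeRing; fromCommutativeRing)

open ≡-Reasoning

-- The zero test lets the normaliser cancel monomials such as a * u - a * u.
ℚ-ring : AlmostCommutativeRing _ _
ℚ-ring = fromCommutativeRing +-*-commutativeRing (λ x → dec⇒maybe (0ℚ ≟ x))

sumℚ-++ : ∀ xs ys → sumℚ (xs ++ ys) ≡ sumℚ xs + sumℚ ys
sumℚ-++ []       ys = sym (+-identityˡ _)
sumℚ-++ (x ∷ xs) ys = trans (cong (x +_) (sumℚ-++ xs ys)) (sym (+-assoc x _ _))

module _ {B : Set} where

  sumℚ-map-++ : ∀ (h : B → ℚ) xs ys → sumℚ (map h (xs ++ ys)) ≡ sumℚ (map h xs) + sumℚ (map h ys)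
  sumℚ-map-++ h xs ys = trans (cong sumℚ (map-++ h xs ys)) (sumℚ-++ (map h xs) (map h ys))

  sumℚ-map-*ˡ : ∀ c (h : B → ℚ) xs → sumℚ (map (λ a → c * h a) xs) ≡ c * sumℚ (map h xs)
  sumℚ-map-*ˡ c h []       = sym (*-zeroʳ c)
  sumℚ-map-*ˡ c h (x ∷ xs) = trans (cong (c * h x +_) (sumℚ-map-*ˡ c h xs)) (sym (*-distribˡ-+ c _ _))

  sumℚ-map-+ : ∀ (f g : B → ℚ) xs → sumℚ (map (λ a → f a + g a) xs) ≡ sumℚ (map f xs) + sumℚ (map g xs)
  sumℚ-map-+ f g []       = sym (+-identityˡ 0ℚ)
  sumℚ-map-+ f g (x ∷ xs) = trans (cong (f x + g x +_) (sumℚ-map-+ f g xs)) (interchange (f x) (g x) _ _)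
    where
    interchange : ∀ a b c e → (a + b) + (c + e) ≡ (a + c) + (b + e)
    interchange = solve-∀ ℚ-ring

mix : ℚ → ℚ → ℚ → ℚ
mix a u v = a * u + (1ℚ - a) * v

-- solve-∀ reads the goal syntactically, so identities about mix are solved unfolded.
mix-idem : ∀ a u → mix a u u ≡ u
mix-idem = ring
  where
  ring : ∀ a u → a * u + (1ℚ - a) * u ≡ u
  ring = solve-∀ ℚ-ring

mix-interchange : ∀ a b p q r s → mix a (mix b p q) (mix b r s) ≡ mix b (mix a p r) (mix a q s)
mix-interchange = ring
  where
  ring : ∀ a b p q r s → a * (b * p + (1ℚ - b) * q) + (1ℚ - a) * (b * r + (1ℚ - b) * s)
                      ≡ b * (a * p + (1ℚ - a) * r) + (1ℚ - b) * (a * q + (1ℚ - a) * s)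
  ring = solve-∀ ℚ-ring

bernoulli : ℚ → Bool → ℚ
bernoulli a b = if b then a else 1ℚ - a

expectation : {n : ℕ} → (Fin n → ℚ) → (Subset n → ℚ) → ℚ
expectation {n} x f = sumℚ (map (λ A → probSet x A * f A) (allSubsets n))

module _ {n : ℕ} where

  probSet-∷ : ∀ (x : Fin (suc n) → ℚ) b (A : Subset n) →
              probSet x (b ∷ A) ≡ bernoulli (x zero) b * probSet (x ∘ suc) A
  probSet-∷ x b A = cong (bernoulli (x zero) b *_)
    (cong prodℚ (trans (map-tabulate (Fin.suc {n}) outcome) (sym (map-tabulate id (outcome ∘ suc)))))
    where
    outcome : Fin (suc n) → ℚ
    outcome v = bernoulli (x v) (lookup (b ∷ A) v)

  expectation-suc : ∀ (x : Fin (suc n) → ℚ) f →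
    expectation x f ≡ mix (x zero) (expectation (x ∘ suc) (f ∘ (true ∷_)))
                                   (expectation (x ∘ suc) (f ∘ (false ∷_)))
  expectation-suc x f = trans (sumℚ-map-++ weighted (map (true ∷_) S) (map (false ∷_) S))
                              (cong₂ _+_ (branch true) (branch false))
    where
    S : List (Subset n)
    S = allSubsets n
    weighted : Subset (suc n) → ℚ
    weighted A = probSet x A * f A
    branch : ∀ b → sumℚ (map weighted (map (b ∷_) S))
                   ≡ bernoulli (x zero) b * expectation (x ∘ suc) (f ∘ (b ∷_))
    branch b = begin
      sumℚ (map weighted (map (b ∷_) S))
        ≡⟨ cong sumℚ (sym (map-∘ S)) ⟩
      sumℚ (map (weighted ∘ (b ∷_)) S)
        ≡⟨ cong sumℚ (map-cong (λ A → trans (cong (_* f (b ∷ A)) (probSet-∷ x b A)) (*-assoc (bernoulli (x zero) b) _ _)) S) ⟩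
      sumℚ (map (λ A → bernoulli (x zero) b * (probSet (x ∘ suc) A * f (b ∷ A))) S)
        ≡⟨ sumℚ-map-*ˡ (bernoulli (x zero) b) (λ A → probSet (x ∘ suc) A * f (b ∷ A)) S ⟩
      bernoulli (x zero) b * expectation (x ∘ suc) (f ∘ (b ∷_)) ∎

  expectation-cong : ∀ (x : Fin n → ℚ) {f g} → (∀ A → f A ≡ g A) → expectation x f ≡ expectation x g
  expectation-cong x f≗g = cong sumℚ (map-cong (λ A → cong (probSet x A *_) (f≗g A)) (allSubsets n))

  expectation-+ : ∀ (x : Fin n → ℚ) f g →
    expectation x (λ A → f A + g A) ≡ expectation x f + expectation x g
  expectation-+ x f g = trans
    (cong sumℚ (map-cong (λ A → *-distribˡ-+ (probSet x A) (f A) (g A)) (allSubsets n)))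
    (sumℚ-map-+ (λ A → probSet x A * f A) (λ A → probSet x A * g A) (allSubsets n))

expectation-const : ∀ {n} (x : Fin n → ℚ) c → expectation x (const c) ≡ c
expectation-const {zero}  x c = trans (+-identityʳ _) (*-identityˡ c)
expectation-const {suc n} x c = begin
  expectation x (const c)
    ≡⟨ expectation-suc x (const c) ⟩
  mix (x zero) (expectation (x ∘ suc) (const c)) (expectation (x ∘ suc) (const c))
    ≡⟨ cong₂ (mix (x zero)) (expectation-const (x ∘ suc) c) (expectation-const (x ∘ suc) c) ⟩
  mix (x zero) c c
    ≡⟨ mix-idem (x zero) c ⟩
  c ∎

expectation-condition : ∀ {n} (x : Fin n → ℚ) v f →
  expectation x f ≡ mix (x v) (expectation x (λ A → f (A [ v ]≔ true)))
                              (expectation x (λ A → f (A [ v ]≔ false)))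
expectation-condition {suc n} x zero f = begin
  expectation x f
    ≡⟨ expectation-suc x f ⟩
  mix (x zero) (expectation x′ (f ∘ (true ∷_))) (expectation x′ (f ∘ (false ∷_)))
    ≡⟨ sym (cong₂ (mix (x zero)) (headFixed true) (headFixed false)) ⟩
  mix (x zero) (expectation x (λ A → f (A [ zero ]≔ true))) (expectation x (λ A → f (A [ zero ]≔ false))) ∎
  where
  x′ : Fin n → ℚ
  x′ = x ∘ suc
  headFixed : ∀ b → expectation x (λ A → f (A [ zero ]≔ b)) ≡ expectation x′ (f ∘ (b ∷_))
  headFixed b = trans (expectation-suc x _) (mix-idem (x zero) _)
expectation-condition {suc n} x (suc v) f = begin
  expectation x f
    ≡⟨ expectation-suc x f ⟩
  mix (x zero) (expectation x′ (f ∘ (true ∷_))) (expectation x′ (f ∘ (false ∷_)))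
    ≡⟨ cong₂ (mix (x zero)) (expectation-condition x′ v _) (expectation-condition x′ v _) ⟩
  mix (x zero) (mix (x (suc v)) _ _) (mix (x (suc v)) _ _)
    ≡⟨ mix-interchange (x zero) (x (suc v)) _ _ _ _ ⟩
  mix (x (suc v)) (mix (x zero) _ _) (mix (x zero) _ _)
    ≡⟨ sym (cong₂ (mix (x (suc v))) (expectation-suc x _) (expectation-suc x _)) ⟩
  mix (x (suc v)) (expectation x (λ A → f (A [ suc v ]≔ true))) (expectation x (λ A → f (A [ suc v ]≔ false))) ∎
  where
  x′ : Fin n → ℚ
  x′ = x ∘ suc

restrict-update-∉ : ∀ {n} (A : Subset n) {v} b {L} → All (v ≢_) L → restrict (A [ v ]≔ b) L ≡ restrict A L
restrict-update-∉ A b []                = refl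
restrict-update-∉ A b (v≢w ∷ v∉L)
  rewrite lookup∘update′ (v≢w ∘ sym) A b | restrict-update-∉ A b v∉L = refl

restrict-update-head : ∀ {n} (A : Subset n) {v} b {L} → All (v ≢_) L →
  restrict (A [ v ]≔ b) (v ∷ L) ≡ (if b then v ∷ restrict A L else restrict A L)
restrict-update-head A {v} b v∉L rewrite lookup∘update v A b | restrict-update-∉ A b v∉L = refl

module ClosedForm {n : ℕ} (d : Fin n → Fin n → ℚ) (x : Fin n → ℚ) where

  activeMass : List (Fin n) → ℚ
  activeMass L = sumℚ (map x L)

  -- The leg from u to the first active vertex w of L is counted once in the latency of w
  -- and of every active vertex after it.
  firstLegCost : Fin n → List (Fin n) → ℚ
  firstLegCost u []      = 0ℚ
  firstLegCost u (v ∷ L) = mix (x v) (d u v * (1ℚ + activeMass L)) (firstLegCost u L)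

  laterLegsCost : List (Fin n) → ℚ
  laterLegsCost []      = 0ℚ
  laterLegsCost (v ∷ L) = x v * firstLegCost v L + laterLegsCost L

  latencySum : Fin n → ℚ → List (Fin n) → Subset n → ℚ
  latencySum u acc L A = sumℚ (latencies d u acc (restrict A L))

  expectation-latencySum : ∀ L → Unique L → ∀ u acc →
    expectation x (latencySum u acc L) ≡ acc * activeMass L + firstLegCost u L + laterLegsCost L
  expectation-latencySum []      []           u acc = trans (expectation-const x 0ℚ) (ring acc)
    where
    ring : ∀ acc → 0ℚ ≡ acc * 0ℚ + 0ℚ + 0ℚ
    ring = solve-∀ ℚ-ring
  expectation-latencySum (v ∷ L) (v∉L ∷ uniq) u acc = begin
    expectation x (latencySum u acc (v ∷ L))
      ≡⟨ expectation-condition x v _ ⟩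
    mix (x v) (expectation x (latencySum u acc (v ∷ L) ∘ (_[ v ]≔ true)))
              (expectation x (latencySum u acc (v ∷ L) ∘ (_[ v ]≔ false)))
      ≡⟨ cong₂ (mix (x v)) active inactive ⟩
    mix (x v) (acc′ + (acc′ * activeMass L + firstLegCost v L + laterLegsCost L))
              (acc * activeMass L + firstLegCost u L + laterLegsCost L)
      ≡⟨ ring (x v) acc (d u v) (activeMass L) (firstLegCost v L) (firstLegCost u L) (laterLegsCost L) ⟩
    acc * activeMass (v ∷ L) + firstLegCost u (v ∷ L) + laterLegsCost (v ∷ L) ∎
    where
    acc′ : ℚ
    acc′ = acc + d u v
    active : expectation x (latencySum u acc (v ∷ L) ∘ (_[ v ]≔ true))
             ≡ acc′ + (acc′ * activeMass L + firstLegCost v L + laterLegsCost L)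
    active = begin
      expectation x (latencySum u acc (v ∷ L) ∘ (_[ v ]≔ true))
        ≡⟨ expectation-cong x (λ A → cong (sumℚ ∘ latencies d u acc) (restrict-update-head A true v∉L)) ⟩
      expectation x (λ A → acc′ + latencySum v acc′ L A)
        ≡⟨ expectation-+ x (const acc′) (latencySum v acc′ L) ⟩
      expectation x (const acc′) + expectation x (latencySum v acc′ L)
        ≡⟨ cong₂ _+_ (expectation-const x acc′) (expectation-latencySum L uniq v acc′) ⟩
      acc′ + (acc′ * activeMass L + firstLegCost v L + laterLegsCost L) ∎
    inactive : expectation x (latencySum u acc (v ∷ L) ∘ (_[ v ]≔ false))
               ≡ acc * activeMass L + firstLegCost u L + laterLegsCost L
    inactive = trans (expectation-cong x (λ A → cong (sumℚ ∘ latencies d u acc) (restrict-update-head A false v∉L)))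
                     (expectation-latencySum L uniq u acc)
    ring : ∀ a acc δ m f f′ l →
      a * ((acc + δ) + ((acc + δ) * m + f + l)) + (1ℚ - a) * (acc * m + f′ + l)
      ≡ acc * (a + m) + (a * (δ * (1ℚ + m)) + (1ℚ - a) * f′) + (a * f + l)
    ring = solve-∀ ℚ-ring

  expectedLatency-closedForm : ∀ r π → Unique π → expectedLatency d r π x ≡ firstLegCost r π + laterLegsCost π
  expectedLatency-closedForm r π uniq =
    trans (expectation-latencySum π uniq r 0ℚ) (ring (activeMass π) (firstLegCost r π) (laterLegsCost π))
    where
    ring : ∀ m f l → 0ℚ * m + f + l ≡ f + l
    ring = solve-∀ ℚ-ring

0≤1 : 0ℚ ≤ 1ℚ
0≤1 = nonNegative⁻¹ 1ℚ

0≤p⇒0≤q⇒0≤p*q : ∀ {p q} → 0ℚ ≤ p → 0ℚ ≤ q → 0ℚ ≤ p * q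
0≤p⇒0≤q⇒0≤p*q {p} {q} 0≤p 0≤q = nonNegative⁻¹ (p * q) {{nonNeg*nonNeg⇒nonNeg p {{nonNegative 0≤p}} q {{nonNegative 0≤q}}}}

*-mono-≤-nonNeg : ∀ {p q r s} → 0ℚ ≤ p → p ≤ q → 0ℚ ≤ r → r ≤ s → p * r ≤ q * s
*-mono-≤-nonNeg {p} {q} {r} {s} 0≤p p≤q 0≤r r≤s =
  ≤-trans (*-monoʳ-≤-nonNeg r {{nonNegative 0≤r}} p≤q) (*-monoˡ-≤-nonNeg q {{nonNegative (≤-trans 0≤p p≤q)}} r≤s)

p≤1⇒0≤1-p : ∀ {p} → p ≤ 1ℚ → 0ℚ ≤ 1ℚ - p
p≤1⇒0≤1-p {p} p≤1 = subst (_≤ 1ℚ - p) (+-inverseʳ p) (+-monoˡ-≤ (- p) p≤1)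

p≤q⇒1-q≤1-p : ∀ {p q} → p ≤ q → 1ℚ - q ≤ 1ℚ - p
p≤q⇒1-q≤1-p p≤q = +-monoʳ-≤ 1ℚ (neg-antimono-≤ p≤q)

p≤1⇒p*q≤q : ∀ {p q} → p ≤ 1ℚ → 0ℚ ≤ q → p * q ≤ q
p≤1⇒p*q≤q {p} {q} p≤1 0≤q = subst (p * q ≤_) (*-identityˡ q) (*-monoʳ-≤-nonNeg q {{nonNegative 0≤q}} p≤1)

p≤0⇒0≤q⇒p*q≤0 : ∀ {p q} → p ≤ 0ℚ → 0ℚ ≤ q → p * q ≤ 0ℚ
p≤0⇒0≤q⇒p*q≤0 {p} {q} p≤0 0≤q = nonPositive⁻¹ (p * q) {{nonPos*nonNeg⇒nonPos p {{nonPositive p≤0}} q {{nonNegative 0≤q}}}}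

p≤0⇒p*p*p≤0 : ∀ {p} → p ≤ 0ℚ → p * p * p ≤ 0ℚ
p≤0⇒p*p*p≤0 {p} p≤0 = nonPositive⁻¹ (p * p * p)
  {{nonNeg*nonPos⇒nonPos (p * p) {{nonPos*nonPos⇒nonPos p {{p≤0′}} p {{p≤0′}}}} p {{p≤0′}}}}
  where
  p≤0′ : NonPositive p
  p≤0′ = nonPositive p≤0

module Bounds {n : ℕ} (d : Fin n → Fin n → ℚ) (0≤d : ∀ u w → 0ℚ ≤ d u w)
              (x : Fin n → ℚ) (0≤x : ∀ v → 0ℚ ≤ x v) (x≤1 : ∀ v → x v ≤ 1ℚ) where
  open ClosedForm d x

  activeMass-nonNeg : ∀ L → 0ℚ ≤ activeMass L
  activeMass-nonNeg []      = ≤-refl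
  activeMass-nonNeg (v ∷ L) = +-mono-≤ (0≤x v) (activeMass-nonNeg L)

  1+activeMass-nonNeg : ∀ L → 0ℚ ≤ 1ℚ + activeMass L
  1+activeMass-nonNeg L = +-mono-≤ 0≤1 (activeMass-nonNeg L)

  firstLegCost-nonNeg : ∀ u L → 0ℚ ≤ firstLegCost u L
  firstLegCost-nonNeg u []      = ≤-refl
  firstLegCost-nonNeg u (v ∷ L) = +-mono-≤
    (0≤p⇒0≤q⇒0≤p*q (0≤x v) (0≤p⇒0≤q⇒0≤p*q (0≤d u v) (1+activeMass-nonNeg L)))
    (0≤p⇒0≤q⇒0≤p*q (p≤1⇒0≤1-p (x≤1 v)) (firstLegCost-nonNeg u L))

  laterLegsCost-nonNeg : ∀ L → 0ℚ ≤ laterLegsCost L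
  laterLegsCost-nonNeg []      = ≤-refl
  laterLegsCost-nonNeg (v ∷ L) = +-mono-≤ (0≤p⇒0≤q⇒0≤p*q (0≤x v) (firstLegCost-nonNeg v L)) (laterLegsCost-nonNeg L)

  expectedLatency-nonNeg : ∀ r π → Unique π → 0ℚ ≤ expectedLatency d r π x
  expectedLatency-nonNeg r π uniq = subst (0ℚ ≤_) (sym (expectedLatency-closedForm r π uniq))
    (+-mono-≤ (firstLegCost-nonNeg r π) (laterLegsCost-nonNeg π))

module Comparison {n : ℕ} (d : Fin n → Fin n → ℚ) (0≤d : ∀ u w → 0ℚ ≤ d u w)
                  (q p : Fin n → ℚ) (0≤p : ∀ v → 0ℚ ≤ p v) (p≤1 : ∀ v → p v ≤ 1ℚ)
                  (β : ℚ) (0≤β : 0ℚ ≤ β) (β≤1 : β ≤ 1ℚ)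
                  (βp≤q : ∀ v → β * p v ≤ q v) (q≤p : ∀ v → q v ≤ p v) where
  module Q = ClosedForm d q
  module P = ClosedForm d p
  open Bounds d 0≤d p 0≤p p≤1

  0≤β*β : 0ℚ ≤ β * β
  0≤β*β = 0≤p⇒0≤q⇒0≤p*q 0≤β 0≤β

  activeMass-mono : ∀ L → β * P.activeMass L ≤ Q.activeMass L
  activeMass-mono []      = ≤-reflexive (*-zeroʳ β)
  activeMass-mono (v ∷ L) = subst (_≤ Q.activeMass (v ∷ L)) (sym (*-distribˡ-+ β (p v) (P.activeMass L)))
    (+-mono-≤ (βp≤q v) (activeMass-mono L))

  1+activeMass-mono : ∀ L → β * (1ℚ + P.activeMass L) ≤ 1ℚ + Q.activeMass L
  1+activeMass-mono L = subst (_≤ 1ℚ + Q.activeMass L)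
    (sym (trans (*-distribˡ-+ β 1ℚ (P.activeMass L)) (cong (_+ β * P.activeMass L) (*-identityʳ β))))
    (+-mono-≤ β≤1 (activeMass-mono L))

  firstLegCost-mono : ∀ u L → β * β * P.firstLegCost u L ≤ Q.firstLegCost u L
  firstLegCost-mono u []      = ≤-reflexive (*-zeroʳ (β * β))
  firstLegCost-mono u (v ∷ L) = subst (_≤ Q.firstLegCost u (v ∷ L))
    (sym (ring β (p v) (d u v) (P.activeMass L) (P.firstLegCost u L)))
    (+-mono-≤
      (*-mono-≤-nonNeg (0≤p⇒0≤q⇒0≤p*q 0≤β (0≤p v)) (βp≤q v) (0≤p⇒0≤q⇒0≤p*q (0≤d u v) 0≤β*count)
                       (*-mono-≤-nonNeg (0≤d u v) ≤-refl 0≤β*count (1+activeMass-mono L)))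
      (*-mono-≤-nonNeg (p≤1⇒0≤1-p (p≤1 v)) (p≤q⇒1-q≤1-p (q≤p v))
                       (0≤p⇒0≤q⇒0≤p*q 0≤β*β (firstLegCost-nonNeg u L)) (firstLegCost-mono u L)))
    where
    0≤β*count : 0ℚ ≤ β * (1ℚ + P.activeMass L)
    0≤β*count = 0≤p⇒0≤q⇒0≤p*q 0≤β (1+activeMass-nonNeg L)
    ring : ∀ b a δ m f → b * b * (a * (δ * (1ℚ + m)) + (1ℚ - a) * f)
                        ≡ (b * a) * (δ * (b * (1ℚ + m))) + (1ℚ - a) * (b * b * f)
    ring = solve-∀ ℚ-ring

  laterLegsCost-mono : ∀ L → β * β * β * P.laterLegsCost L ≤ Q.laterLegsCost L
  laterLegsCost-mono []      = ≤-reflexive (*-zeroʳ (β * β * β))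
  laterLegsCost-mono (v ∷ L) = subst (_≤ Q.laterLegsCost (v ∷ L))
    (sym (ring β (p v) (P.firstLegCost v L) (P.laterLegsCost L)))
    (+-mono-≤ (*-mono-≤-nonNeg (0≤p⇒0≤q⇒0≤p*q 0≤β (0≤p v)) (βp≤q v)
                               (0≤p⇒0≤q⇒0≤p*q 0≤β*β (firstLegCost-nonNeg v L)) (firstLegCost-mono v L))
              (laterLegsCost-mono L))
    where
    ring : ∀ b a f l → b * b * b * (a * f + l) ≡ (b * a) * (b * b * f) + b * b * b * l
    ring = solve-∀ ℚ-ring

  expectedLatency-mono : ∀ r π → Unique π → β * β * β * expectedLatency d r π p ≤ expectedLatency d r π q
  expectedLatency-mono r π uniq = subst₂ _≤_
    (sym (trans (cong (β * β * β *_) (P.expectedLatency-closedForm r π uniq)) (ring β (P.firstLegCost r π) (P.laterLegsCost π))))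
    (sym (Q.expectedLatency-closedForm r π uniq))
    (+-mono-≤ (≤-trans (p≤1⇒p*q≤q β≤1 (0≤p⇒0≤q⇒0≤p*q 0≤β*β (firstLegCost-nonNeg r π))) (firstLegCost-mono r π))
              (laterLegsCost-mono π))
    where
    ring : ∀ b f l → b * b * b * (f + l) ≡ b * (b * b * f) + b * b * b * l
    ring = solve-∀ ℚ-ring

masterTour-unique : ∀ {n} (r : Fin n) π → IsMasterTour r π → Unique π
masterTour-unique {n} r π (_ , _ , π↭allFin) = ↭ₛ.Unique-resp-↭ (setoid (Fin n)) (↭⇒↭ₛ (↭-sym π↭allFin)) (allFin⁺ n)

lemma3 : (n : ℕ) (d : Fin n → Fin n → ℚ) → IsMetric d →
         (r : Fin n) (π : List (Fin n)) → IsMasterTour r π →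
         (q p̄ : Fin n → ℚ) →
         (∀ v → 0ℚ ≤ q v) → (∀ v → q v ≤ 1ℚ) →
         (∀ v → 0ℚ ≤ p̄ v) → (∀ v → p̄ v ≤ 1ℚ) →
         (β : ℚ) → β ≤ 1ℚ →
         (∀ v → β * p̄ v ≤ q v) → (∀ v → q v ≤ p̄ v) →
         (β * β * β) * expectedLatency d r π p̄ ≤ expectedLatency d r π q
lemma3 n d metric r π tour q p̄ 0≤q q≤1 0≤p̄ p̄≤1 β β≤1 βp̄≤q q≤p̄ = [ nonNegCase , nonPosCase ]′ (≤-total 0ℚ β)
  where
  0≤d : ∀ u w → 0ℚ ≤ d u w
  0≤d = IsMetric.nonneg metric
  uniq : Unique π
  uniq = masterTour-unique r π tour
  nonNegCase : 0ℚ ≤ β → β * β * β * expectedLatency d r π p̄ ≤ expectedLatency d r π q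
  nonNegCase 0≤β = Comparison.expectedLatency-mono d 0≤d q p̄ 0≤p̄ p̄≤1 β 0≤β β≤1 βp̄≤q q≤p̄ r π uniq
  nonPosCase : β ≤ 0ℚ → β * β * β * expectedLatency d r π p̄ ≤ expectedLatency d r π q
  nonPosCase β≤0 = ≤-trans (p≤0⇒0≤q⇒p*q≤0 (p≤0⇒p*p*p≤0 β≤0) (Bounds.expectedLatency-nonNeg d 0≤d p̄ 0≤p̄ p̄≤1 r π uniq))
                           (Bounds.expectedLatency-nonNeg d 0≤d q 0≤q q≤1 r π uniq)
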